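{- (1) Every variable is computable. (2) Every computable term is terminating. (3) If $s$ is computable and $s \sqsupseteq t$, then $t$ is computable.
   Context: Simply typed terms: there is a single base type (sort) $\iota$; types are $\iota$ and $\sigma \Rightarrow \tau$. Given a set of typed variables (infinitely many of each type) and a possibly infinite set of typed function symbols, terms are built from variables and function symbols by type-respecting application: if $s :: \sigma \Rightarrow \tau$ and $t :: \sigma$ then $s\ t :: \tau$ (left-associative). Every term has the form $a\ s_1 \cdots s_n$ ($n\ge 0$) with $a$ a variable or function symbol. Fixed data: a precedence $\unrhd$ (a quasi-ordering on function symbols whose strict part $\rhd$ is well-founded; $\equiv$ denotes $\unrhd \cap \unlhd$), and a filter $\pi$ assigning to each $\mathsf{f} :: \sigma_1 \Rightarrow \dots \Rightarrow \sigma_m \Rightarrow \iota$ a set $\pi(\mathsf{f}) \subseteq \{1,\dots,m\}$; for each $\mathsf{f}$ the arities of the symbols $\mathsf{g} \equiv \mathsf{f}$ are bounded. Equivalence: $s \approx t$ iff $s,t$ have the same type and either (Eq-mono) $s = x\ s_1 \cdots s_n$, $t = x\ t_1 \cdots t_n$, $x$ a variable, $s_i \approx t_i$ for all $i$; or (Eq-args) $s = \mathsf{f}\ s_1 \cdots s_n$, $t = \mathsf{g}\ t_1 \cdots t_n$, $\mathsf{f},\mathsf{g}$ function symbols of the same type, $\mathsf{f} \equiv \mathsf{g}$, $\pi(\mathsf{f}) = \pi(\mathsf{g})$, $s_i \approx t_i$ for all $i \in \pi(\mathsf{f}) \cap \{1,\dots,n\}$. The relations $\sqsupseteq, \sqsupset,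 \sqsupset\!\!\sqsupset$ are the least relations such that: $s \sqsupseteq t$ iff $s \approx t$ or $s \sqsupset t$. $s \sqsupset t$ if $s,t$ have the same type and one of: (Gr-mono) $s = x\ s_1 \cdots s_n$, $t = x\ t_1 \cdots t_n$, $x$ a variable, $s_i \sqsupseteq t_i$ for all $i$ and $s_i \sqsupset t_i$ for some $i$; (Gr-args) $s = \mathsf{f}\ s_1 \cdots s_n$, $t = \mathsf{g}\ t_1 \cdots t_n$, $\mathsf{f},\mathsf{g}$ of the same type, $\mathsf{f} \equiv \mathsf{g}$, $\pi(\mathsf{f}) = \pi(\mathsf{g})$, $s_i \sqsupseteq t_i$ for all $i \in \pi(\mathsf{f}) \cap \{1,\dots,n\}$ and $s_i \sqsupset t_i$ for some such $i$; (Gr-rpo) $s \sqsupset\!\!\sqsupset t$. $s \sqsupset\!\!\sqsupset t$ ($s,t$ possibly of different types) if $s = \mathsf{f}\ s_1 \cdots s_n$ with $\mathsf{f} :: \sigma_1 \Rightarrow \dots \Rightarrow \sigma_m \Rightarrow \iota$, $\{n+1,\dots,m\} \subseteq \pi(\mathsf{f})$, and one of: (Rpo-select) $s_i \sqsupseteq t$ for some $i \in \pi(\mathsf{f}) \cap \{1,\dots,n\}$; (Rpo-appl) $t = t_0\ t_1 \cdots t_k$ with $k \ge 1$ and $s \sqsupset\!\!\sqsupset t_i$ for all $0 \le i \le k$; (Rpo-copy) $t = \mathsf{g}\ t_1 \cdots t_k$ with $\mathsf{f} \rhd \mathsf{g}$ and $s \sqsupset\!\!\sqsupset t_i$ for all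 $i \in \pi(\mathsf{g}) \cap \{1,\dots,k\}$; (Rpo-lex) $t = \mathsf{g}\ t_1 \cdots t_k$ with $\mathsf{f} \equiv \mathsf{g}$ and there is $i \in \pi(\mathsf{f}) \cap \pi(\mathsf{g}) \cap \{1,\dots,\min(n,k)\}$ with $\pi(\mathsf{f}) \cap \{1,\dots,i\} = \pi(\mathsf{g}) \cap \{1,\dots,i\}$, $s_j \approx t_j$ for all $j \in \{1,\dots,i-1\} \cap \pi(\mathsf{f})$, $s_i \sqsupset t_i$, and $s \sqsupset\!\!\sqsupset t_j$ for all $j \in \{i+1,\dots,k\} \cap \pi(\mathsf{g})$. A term $s$ is terminating if there is no infinite sequence $s \sqsupset s_1 \sqsupset s_2 \sqsupset \cdots$. By induction on types: a term $s :: \sigma_1 \Rightarrow \dots \Rightarrow \sigma_m \Rightarrow \iota$ is computable if for all computable $t_1 :: \sigma_1, \dots, t_m :: \sigma_m$ the term $s\ t_1 \cdots t_m$ is terminating. -}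

module Defs where

open import Data.Nat using (ℕ; zero; suc; _≤_; _<_)
open import Data.Bool using (Bool; T)
open import Data.Product using (Σ; Σ-syntax; ∃; ∃-syntax; _×_; _,_)
open import Relation.Nullary using (¬_)
open import Relation.Binary.PropositionalEquality using (_≡_)
open import Relation.Binary.Structures using (IsPreorder)
open import Induction.WellFounded using (WellFounded; Acc)

infixr 5 _⇒_

data Ty : Set where
  ι   : Ty
  _⇒_ : Ty → Ty → Ty

arity : Ty → ℕ
arity ι       = 0
arity (σ ⇒ τ) = suc (arity τ)

record Setup : Set₁ where
  field
    Sym          : Set
    ty           : Sym → Ty
    _⊵_          : Sym → Sym → Set
    ⊵-isPreorder : IsPreorder _≡_ _⊵_
    ▷-wf         : WellFounded (λ g f → (f ⊵ g) × ¬ (g ⊵ f))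
    -- the filter: π f i is true iff position i (1-based) belongs to π(f)
    π            : Sym → ℕ → Bool
    π-⊆          : ∀ f i → T (π f i) → (1 ≤ i) × (i ≤ arity (ty f))
    arity-bound  : ∀ f → ∃[ N ] (∀ g → g ⊵ f → f ⊵ g → arity (ty g) ≤ N)

module Terms (S : Setup) where
  open Setup S public

  _▷_ : Sym → Sym → Set
  f ▷ g = (f ⊵ g) × ¬ (g ⊵ f)

  _≡ₚ_ : Sym → Sym → Set
  f ≡ₚ g = (f ⊵ g) × (g ⊵ f)

  data Head : Ty → Set where
    var : (σ : Ty) → ℕ → Head σ
    fun : (f : Sym) → Head (ty f)

  infixr 5 _∷_
  infix  4 _#_

  -- every term has the form  a s₁ ⋯ sₙ ;  Args σ τ : argument lists
  -- s₁ ⋯ sₙ turning a head of type σ into a term of type τ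
  mutual
    data Tm : Ty → Set where
      _#_ : ∀ {σ τ} → Head σ → Args σ τ → Tm τ

    data Args : Ty → Ty → Set where
      []  : ∀ {σ} → Args σ σ
      _∷_ : ∀ {σ τ ρ} → Tm σ → Args τ ρ → Args (σ ⇒ τ) ρ

  snoc : ∀ {ρ σ τ} → Args ρ (σ ⇒ τ) → Tm σ → Args ρ τ
  snoc []       t = t ∷ []
  snoc (s ∷ ss) t = s ∷ snoc ss t

  _++_ : ∀ {ρ σ τ} → Args ρ σ → Args σ τ → Args ρ τ
  []       ++ ts = ts
  (s ∷ ss) ++ ts = s ∷ (ss ++ ts)

  app : ∀ {σ τ} → Tm (σ ⇒ τ) → Tm σ → Tm τ
  app (h # ss) t = h # snoc ss t

  len : ∀ {σ τ} → Args σ τ → ℕ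
  len []       = 0
  len (_ ∷ ss) = suc (len ss)

  v : (σ : Ty) → ℕ → Tm σ
  v σ x = var σ x # []

  -- ss [ i ]= a : the i-th argument (1-based) of ss is a
  data _[_]=_ : ∀ {σ τ ρ} → Args σ τ → ℕ → Tm ρ → Set where
    here  : ∀ {σ τ ρ} {s : Tm σ} {ss : Args τ ρ} → (s ∷ ss) [ 1 ]= s
    there : ∀ {σ τ ρ α i} {s : Tm σ} {ss : Args τ ρ} {a : Tm α} →
            ss [ i ]= a → (s ∷ ss) [ suc i ]= a

  Padded : (f : Sym) → ∀ {ρ} → Args (ty f) ρ → Set
  Padded f ss = ∀ j → len ss < j → j ≤ arity (ty f) → T (π f j)

  -- Equivalence ≈ (relations are stated heterogeneously; the
  -- constructors only relate terms of the same type)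
  infix 4 _≈_ _⊐_ _⊒_ _⊐⊐_

  data _≈_ : ∀ {σ τ} → Tm σ → Tm τ → Set where
    eq-mono : ∀ {σ ρ} (x : ℕ) (ss ts : Args σ ρ) →
      (∀ {i α β} {a : Tm α} {b : Tm β} → ss [ i ]= a → ts [ i ]= b → a ≈ b) →
      (var σ x # ss) ≈ (var σ x # ts)
    eq-args : ∀ {ρ} (f g : Sym) (ss : Args (ty f) ρ) (ts : Args (ty g) ρ) →
      ty f ≡ ty g → f ≡ₚ g → (∀ i → π f i ≡ π g i) →
      (∀ {i α β} {a : Tm α} {b : Tm β} →
         T (π f i) → ss [ i ]= a → ts [ i ]= b → a ≈ b) →
      (fun f # ss) ≈ (fun g # ts)

  mutual
    data _⊒_ : ∀ {σ τ} → Tm σ → Tm τ → Set where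
      ⊒-≈ : ∀ {σ τ} {s : Tm σ} {t : Tm τ} → s ≈ t → s ⊒ t
      ⊒-⊐ : ∀ {σ τ} {s : Tm σ} {t : Tm τ} → s ⊐ t → s ⊒ t

    data _⊐_ : ∀ {σ τ} → Tm σ → Tm τ → Set where
      gr-mono : ∀ {σ ρ} (x : ℕ) (ss ts : Args σ ρ) →
        (∀ {i α β} {a : Tm α} {b : Tm β} → ss [ i ]= a → ts [ i ]= b → a ⊒ b) →
        (Σ[ i ∈ ℕ ] Σ[ α ∈ Ty ] Σ[ β ∈ Ty ] Σ[ a ∈ Tm α ] Σ[ b ∈ Tm β ]
           (ss [ i ]= a) × (ts [ i ]= b) × (a ⊐ b)) →
        (var σ x # ss) ⊐ (var σ x # ts)
      gr-args : ∀ {ρ} (f g : Sym) (ss : Args (ty f) ρ) (ts : Args (ty g) ρ) →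
        ty f ≡ ty g → f ≡ₚ g → (∀ i → π f i ≡ π g i) →
        (∀ {i α β} {a : Tm α} {b : Tm β} →
           T (π f i) → ss [ i ]= a → ts [ i ]= b → a ⊒ b) →
        (Σ[ i ∈ ℕ ] Σ[ α ∈ Ty ] Σ[ β ∈ Ty ] Σ[ a ∈ Tm α ] Σ[ b ∈ Tm β ]
           T (π f i) × (ss [ i ]= a) × (ts [ i ]= b) × (a ⊐ b)) →
        (fun f # ss) ⊐ (fun g # ts)
      gr-rpo : ∀ {σ} {s t : Tm σ} → s ⊐⊐ t → s ⊐ t

    data _⊐⊐_ : ∀ {σ τ} → Tm σ → Tm τ → Set where
      rpo-select : ∀ {ρ τ} (f : Sym) (ss : Args (ty f) ρ) {t : Tm τ} →
        Padded f ss →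
        (Σ[ i ∈ ℕ ] Σ[ α ∈ Ty ] Σ[ a ∈ Tm α ]
           T (π f i) × (ss [ i ]= a) × (a ⊒ t)) →
        (fun f # ss) ⊐⊐ t
      rpo-appl : ∀ {ρ τ α β} (f : Sym) (ss : Args (ty f) ρ) (t : Tm τ)
        (h : Head α) (pre : Args α β) (suf : Args β τ) →
        Padded f ss →
        t ≡ (h # (pre ++ suf)) → 1 ≤ len suf →
        (fun f # ss) ⊐⊐ (h # pre) →
        (∀ {i γ} {a : Tm γ} → suf [ i ]= a → (fun f # ss) ⊐⊐ a) →
        (fun f # ss) ⊐⊐ t
      rpo-copy : ∀ {ρ τ} (f g : Sym) (ss : Args (ty f) ρ) (ts : Args (ty g) τ) →
        Padded f ss →
        f ▷ g →
        (∀ {i γ} {a : Tm γ} → T (π g i) → ts [ i ]= a → (fun f # ss) ⊐⊐ a) →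
        (fun f # ss) ⊐⊐ (fun g # ts)
      rpo-lex : ∀ {ρ τ α β} (f g : Sym) (ss : Args (ty f) ρ) (ts : Args (ty g) τ)
        (i : ℕ) (a : Tm α) (b : Tm β) →
        Padded f ss →
        f ≡ₚ g →
        T (π f i) → T (π g i) → ss [ i ]= a → ts [ i ]= b →
        (∀ j → j ≤ i → π f j ≡ π g j) →
        (∀ {j γ δ} {c : Tm γ} {d : Tm δ} →
           j < i → T (π f j) → ss [ j ]= c → ts [ j ]= d → c ≈ d) →
        a ⊐ b →
        (∀ {j δ} {d : Tm δ} → i < j → T (π g j) → ts [ j ]= d → (fun f # ss) ⊐⊐ d) →
        (fun f # ss) ⊐⊐ (fun g # ts)

  Terminating : ∀ {σ} → Tm σ → Set
  Terminating {σ} s = Acc (λ (u t : Tm σ) → t ⊐ u) s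

  Computable : (σ : Ty) → Tm σ → Set
  Computable ι       s = Terminating s
  Computable (σ ⇒ τ) s = ∀ (t : Tm σ) → Computable σ t → Computable τ (app s t)

-- A variable applied to terminating arguments can only decrease by Gr-mono, i.e. argumentwise
-- with one strict step, and a nested induction on the accessibility of the arguments shows such
-- terms terminating.  Computability is closed under ⊒ because ⊐ and ≈ are stable under
-- application (for ⊐⊐ by Rpo-appl, reaching the new argument by Rpo-select) and because ⊐
-- absorbs ≈ on the left.  The first two statements then follow by the usual simultaneous
-- induction on types: the variable of type σ supplies the computable argument needed to show
-- that a computable term of type σ ⇒ τ terminates.
module Submission where

open import Defs
open import Data.Nat using (ℕ; suc; _+_; _≤_; _<_; z≤n; s≤s)
open import Data.Nat.Properties using (+-cancelʳ-≡; m≤n+m; <-irrefl; n≤1+n; ≤-trans; ≤-refl)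
open import Data.Product using (Σ-syntax; ∃-syntax; _×_; _,_; -,_; map₂)
open import Data.Bool using (T)
open import Data.Unit using (⊤; tt)
open import Data.Empty using (⊥-elim)
open import Relation.Nullary using (¬_)
open import Relation.Binary.PropositionalEquality using (_≡_; refl; sym; trans; cong; subst)
open import Relation.Binary.Bundles using (Preorder; Setoid)
open import Relation.Binary.Properties.Preorder using (InducedEquivalence)
open import Induction.WellFounded using (Acc; acc)

module Properties (S : Setup) where
  open Terms S

  variable
    σ σ′ τ ρ α α′ β γ : Ty
    i j : ℕ
    f g h : Sym

  ⊵-preorder : Preorder _ _ _
  ⊵-preorder = record { isPreorder = ⊵-isPreorder }

  private
    module ⊵ = Preorder ⊵-preorder

  ≡ₚ-trans : f ≡ₚ g → g ≡ₚ h → f ≡ₚ h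
  ≡ₚ-trans = Setoid.trans (InducedEquivalence ⊵-preorder)

  ≡ₚ-▷-trans : f ≡ₚ g → g ▷ h → f ▷ h
  ≡ₚ-▷-trans (f⊵g , _) (g⊵h , h⋬g) =
    ⊵.trans f⊵g g⊵h , λ h⊵f → h⋬g (⊵.trans h⊵f f⊵g)

  HRel : Set₁
  HRel = ∀ {α β} → Tm α → Tm β → Set

  Pointwise : HRel → Args σ ρ → Args τ ρ → Set
  Pointwise R ss ts = ∀ {i α β} {a : Tm α} {b : Tm β} → ss [ i ]= a → ts [ i ]= b → R a b

  Pointwise-on : (ℕ → Set) → HRel → Args σ ρ → Args τ ρ → Set
  Pointwise-on P R ss ts =
    ∀ {i α β} {a : Tm α} {b : Tm β} → P i → ss [ i ]= a → ts [ i ]= b → R a b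

  len+arity : (ss : Args σ ρ) → len ss + arity ρ ≡ arity σ
  len+arity []       = refl
  len+arity (_ ∷ ss) = cong suc (len+arity ss)

  ¬Args-growing : ¬ Args β (α ⇒ β)
  ¬Args-growing {β = β} ss =
    <-irrefl refl (subst (suc (arity β) ≤_) (len+arity ss) (m≤n+m _ (len ss)))

  len-aligned : σ ≡ σ′ → (ss : Args σ ρ) (ts : Args σ′ ρ) → len ss ≡ len ts
  len-aligned {ρ = ρ} refl ss ts =
    +-cancelʳ-≡ (arity ρ) (len ss) (len ts) (trans (len+arity ss) (sym (len+arity ts)))

  aligned : {ss : Args σ ρ} {a : Tm α} → σ ≡ σ′ → (ts : Args σ′ ρ) →
            ss [ i ]= a → ∃[ β ] Σ[ b ∈ Tm β ] ts [ i ]= b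
  aligned refl []       (here {ss = ss})    = ⊥-elim (¬Args-growing ss)
  aligned refl []       (there {ss = ss} _) = ⊥-elim (¬Args-growing ss)
  aligned refl (t ∷ _)  here                = -, t , here
  aligned refl (_ ∷ ts) (there p)           = map₂ (map₂ there) (aligned refl ts p)

  Padded-aligned : {ss : Args (ty f) ρ} {ts : Args (ty g) ρ} → ty f ≡ ty g →
                   (∀ i → π f i ≡ π g i) → Padded g ts → Padded f ss
  Padded-aligned {ss = ss} {ts} e πf≡πg pad j len<j j≤m =
    subst T (sym (πf≡πg j))
      (pad j (subst (_< j) (len-aligned e ss ts) len<j) (subst (λ σ → j ≤ arity σ) e j≤m))

  mutual
    ≈-refl : (s : Tm σ) → s ≈ s
    ≈-refl (var σ x # ss) = eq-mono x ss ss (≈-refl-pointwise ss)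
    ≈-refl (fun f # ss)   =
      eq-args f f ss ss refl (⊵.refl , ⊵.refl) (λ _ → refl) (λ _ → ≈-refl-pointwise ss)

    ≈-refl-pointwise : (ss : Args σ ρ) → Pointwise _≈_ ss ss
    ≈-refl-pointwise (s ∷ _)  here       here      = ≈-refl s
    ≈-refl-pointwise (_ ∷ ss) (there p)  (there q) = ≈-refl-pointwise ss p q
    ≈-refl-pointwise (_ ∷ _)  here       (there ())
    ≈-refl-pointwise (_ ∷ _)  (there ()) here

  ≈-trans : {s : Tm σ} {t : Tm τ} {u : Tm γ} → s ≈ t → t ≈ u → s ≈ u
  ≈-trans (eq-mono x ss ts ss≈ts) (eq-mono .x .ts us ts≈us) =
    eq-mono x ss us λ p r → let _ , _ , q = aligned refl ts p in ≈-trans (ss≈ts p q) (ts≈us q r)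
  ≈-trans (eq-args f g ss ts e f≡g πf≡πg ss≈ts) (eq-args .g h .ts us e′ g≡h πg≡πh ts≈us) =
    eq-args f h ss us (trans e e′) (≡ₚ-trans f≡g g≡h) (λ i → trans (πf≡πg i) (πg≡πh i))
      λ {i} πfi p r → let _ , _ , q = aligned e ts p
                      in ≈-trans (ss≈ts πfi p q) (ts≈us (subst T (πf≡πg i) πfi) q r)

  ≈-ty : {s : Tm σ} {t : Tm τ} → s ≈ t → σ ≡ τ
  ≈-ty (eq-mono _ _ _ _)         = refl
  ≈-ty (eq-args _ _ _ _ _ _ _ _) = refl

  mutual
    ≈-⊒-trans : {s : Tm σ} {t : Tm τ} {u : Tm γ} → s ≈ t → t ⊒ u → s ⊒ u
    ≈-⊒-trans s≈t (⊒-≈ t≈u) = ⊒-≈ (≈-trans s≈t t≈u)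
    ≈-⊒-trans s≈t (⊒-⊐ t⊐u) = ⊒-⊐ (≈-⊐-trans s≈t t⊐u)

    ≈-⊐-trans : {s : Tm σ} {t : Tm τ} {u : Tm γ} → s ≈ t → t ⊐ u → s ⊐ u
    ≈-⊐-trans (eq-mono x ss ts ss≈ts)
              (gr-mono .x .ts us ts⊒us (i , _ , _ , _ , c , q , r , b⊐c)) =
      gr-mono x ss us
        (λ p r → let _ , _ , q = aligned refl ts p in ≈-⊒-trans (ss≈ts p q) (ts⊒us q r))
        (let _ , a , p = aligned refl ss q
         in i , _ , _ , a , c , p , r , ≈-⊐-trans (ss≈ts p q) b⊐c)
    ≈-⊐-trans (eq-args f g ss ts e f≡g πf≡πg ss≈ts)
              (gr-args .g h .ts us e′ g≡h πg≡πh ts⊒us (i , _ , _ , _ , c , πgi , q , r , b⊐c)) =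
      gr-args f h ss us (trans e e′) (≡ₚ-trans f≡g g≡h) (λ i → trans (πf≡πg i) (πg≡πh i))
        (λ {i} πfi p r → let _ , _ , q = aligned e ts p
                         in ≈-⊒-trans (ss≈ts πfi p q) (ts⊒us (subst T (πf≡πg i) πfi) q r))
        (let _ , a , p = aligned (sym e) ss q
             πfi       = subst T (sym (πf≡πg i)) πgi
         in i , _ , _ , a , c , πfi , p , r , ≈-⊐-trans (ss≈ts πfi p q) b⊐c)
    ≈-⊐-trans s≈t (gr-rpo t⊐⊐u) with ≈-ty s≈t
    ... | refl = gr-rpo (≈-⊐⊐-trans s≈t t⊐⊐u)

    ≈-⊐⊐-trans : {s : Tm σ} {t : Tm τ} {u : Tm γ} → s ≈ t → t ⊐⊐ u → s ⊐⊐ u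
    ≈-⊐⊐-trans (eq-args f g ss ts e _ πf≡πg ss≈ts)
               (rpo-select .g .ts pad (i , _ , _ , πgi , q , b⊒u)) =
      rpo-select f ss (Padded-aligned e πf≡πg pad)
        (let _ , a , p = aligned (sym e) ss q
             πfi       = subst T (sym (πf≡πg i)) πgi
         in i , _ , a , πfi , p , ≈-⊒-trans (ss≈ts πfi p q) b⊒u)
    ≈-⊐⊐-trans s≈t@(eq-args f g ss ts e _ πf≡πg _)
               (rpo-appl .g .ts u h pre suf pad u≡ 1≤ t⊐⊐h suf<) =
      rpo-appl f ss u h pre suf (Padded-aligned e πf≡πg pad) u≡ 1≤
        (≈-⊐⊐-trans s≈t t⊐⊐h) (λ q → ≈-⊐⊐-trans s≈t (suf< q))
    ≈-⊐⊐-trans s≈t@(eq-args f g ss ts e f≡g πf≡πg _) (rpo-copy .g h .ts us pad g▷h us<) =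
      rpo-copy f h ss us (Padded-aligned e πf≡πg pad) (≡ₚ-▷-trans f≡g g▷h)
        (λ πhi r → ≈-⊐⊐-trans s≈t (us< πhi r))
    ≈-⊐⊐-trans s≈t@(eq-args f g ss ts e f≡g πf≡πg ss≈ts)
               (rpo-lex .g h .ts us i _ c pad g≡h πgi πhi q r πg≡πh≤i ts≈us<i b⊐c us<) =
      let _ , a , p = aligned (sym e) ss q
          πfi       = subst T (sym (πf≡πg i)) πgi
      in rpo-lex f h ss us i a c (Padded-aligned e πf≡πg pad) (≡ₚ-trans f≡g g≡h) πfi πhi p r
           (λ j j≤i → trans (πf≡πg j) (πg≡πh≤i j j≤i))
           (λ {j} j<i πfj p′ r′ →
              let _ , _ , q′ = aligned e ts p′
              in ≈-trans (ss≈ts πfj p′ q′) (ts≈us<i j<i (subst T (πf≡πg j) πfj) q′ r′))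
           (≈-⊐-trans (ss≈ts πfi p q) b⊐c)
           (λ i<j πhj r′ → ≈-⊐⊐-trans s≈t (us< i<j πhj r′))

  snoc-[]= : {ss : Args ρ (σ ⇒ τ)} {w : Tm σ} {a : Tm α} → ss [ i ]= a → snoc ss w [ i ]= a
  snoc-[]= here      = here
  snoc-[]= (there p) = there (snoc-[]= p)

  snoc-[]=-last : (ss : Args ρ (σ ⇒ τ)) (w : Tm σ) → snoc ss w [ suc (len ss) ]= w
  snoc-[]=-last []       w = here
  snoc-[]=-last (_ ∷ ss) w = there (snoc-[]=-last ss w)

  snoc-[]=⁻ : {ss : Args ρ (σ ⇒ τ)} {w : Tm σ} {a : Tm α} {c : Tm β} →
              snoc ss w [ j ]= c → ss [ i ]= a → j < i → ss [ j ]= c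
  snoc-[]=⁻ {ss = _ ∷ _} here       _         _         = here
  snoc-[]=⁻ {ss = _ ∷ _} (there p)  (there q) (s≤s j<i) = there (snoc-[]=⁻ p q j<i)
  snoc-[]=⁻ {ss = _ ∷ _} (there _)  here      (s≤s ())
  snoc-[]=⁻ {ss = []}    (there ()) _         _

  snoc≡++ : (ss : Args ρ (σ ⇒ τ)) (w : Tm σ) → snoc ss w ≡ ss ++ (w ∷ [])
  snoc≡++ []       w = refl
  snoc≡++ (s ∷ ss) w = cong (s ∷_) (snoc≡++ ss w)

  len-snoc : (ss : Args ρ (σ ⇒ τ)) (w : Tm σ) → len (snoc ss w) ≡ suc (len ss)
  len-snoc []       w = refl
  len-snoc (_ ∷ ss) w = cong suc (len-snoc ss w)

  len<arity : (ss : Args ρ (σ ⇒ τ)) → len ss < arity ρ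
  len<arity []       = s≤s z≤n
  len<arity (_ ∷ ss) = s≤s (len<arity ss)

  Padded-snoc : (ss : Args (ty f) (σ ⇒ τ)) (w : Tm σ) → Padded f ss → Padded f (snoc ss w)
  Padded-snoc ss w pad j len<j = pad j (≤-trans (n≤1+n _) (subst (_< j) (len-snoc ss w) len<j))

  Padded-next : (ss : Args (ty f) (σ ⇒ τ)) → Padded f ss → T (π f (suc (len ss)))
  Padded-next ss pad = pad (suc (len ss)) ≤-refl (len<arity ss)

  snoc-pointwise : (P : ℕ → Set) (R : HRel) {ss : Args α (σ ⇒ τ)} {ts : Args α′ (σ ⇒ τ)}
                   {w : Tm σ} → α ≡ α′ → R w w → Pointwise-on P R ss ts →
                   Pointwise-on P R (snoc ss w) (snoc ts w)
  snoc-pointwise P R {[]}     {[]}     refl Rww _  _  here       here       = Rww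
  snoc-pointwise P R {[]}     {[]}     refl _   _  _  here       (there ())
  snoc-pointwise P R {[]}     {[]}     refl _   _  _  (there ()) _
  snoc-pointwise P R {[]}     {_ ∷ ts} refl _   _  _  _          _          = ⊥-elim (¬Args-growing ts)
  snoc-pointwise P R {_ ∷ ss} {[]}     refl _   _  _  _          _          = ⊥-elim (¬Args-growing ss)
  snoc-pointwise P R {_ ∷ _}  {_ ∷ _}  refl _   R* Pi here       here       = R* Pi here here
  snoc-pointwise P R {_ ∷ _}  {_ ∷ _}  refl _   _  _  here       (there ())
  snoc-pointwise P R {_ ∷ _}  {_ ∷ _}  refl _   _  _  (there ()) here
  snoc-pointwise P R {_ ∷ _}  {_ ∷ _}  refl Rww R* Pi (there p)  (there q)  =
    snoc-pointwise (λ i → P (suc i)) R refl Rww (λ Pi p q → R* Pi (there p) (there q)) Pi p q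

  ⊐⊐-Padded : {ss : Args (ty f) ρ} {t : Tm τ} → (fun f # ss) ⊐⊐ t → Padded f ss
  ⊐⊐-Padded (rpo-select _ _ pad _)                        = pad
  ⊐⊐-Padded (rpo-appl _ _ _ _ _ _ pad _ _ _ _)            = pad
  ⊐⊐-Padded (rpo-copy _ _ _ _ pad _ _)                    = pad
  ⊐⊐-Padded (rpo-lex _ _ _ _ _ _ _ pad _ _ _ _ _ _ _ _ _) = pad

  ⊐⊐-snoc : {ss : Args (ty f) (σ ⇒ τ)} {t : Tm γ} (w : Tm σ) →
            (fun f # ss) ⊐⊐ t → (fun f # snoc ss w) ⊐⊐ t
  ⊐⊐-snoc {ss = ss} w (rpo-select f .ss pad (i , _ , a , πfi , p , a⊒t)) =
    rpo-select f (snoc ss w) (Padded-snoc ss w pad) (i , _ , a , πfi , snoc-[]= p , a⊒t)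
  ⊐⊐-snoc {ss = ss} w (rpo-appl f .ss t h pre suf pad t≡ 1≤ s⊐⊐h suf<) =
    rpo-appl f (snoc ss w) t h pre suf (Padded-snoc ss w pad) t≡ 1≤
      (⊐⊐-snoc w s⊐⊐h) (λ q → ⊐⊐-snoc w (suf< q))
  ⊐⊐-snoc {ss = ss} w (rpo-copy f g .ss ts pad f▷g ts<) =
    rpo-copy f g (snoc ss w) ts (Padded-snoc ss w pad) f▷g (λ πgi q → ⊐⊐-snoc w (ts< πgi q))
  ⊐⊐-snoc {ss = ss} w (rpo-lex f g .ss ts i a b pad f≡g πfi πgi p q πf≡πg≤i ss≈ts<i a⊐b ts<) =
    rpo-lex f g (snoc ss w) ts i a b (Padded-snoc ss w pad) f≡g πfi πgi (snoc-[]= p) q πf≡πg≤i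
      (λ j<i πfj p′ q′ → ss≈ts<i j<i πfj (snoc-[]=⁻ p′ p j<i) q′) a⊐b
      (λ i<j πgj q′ → ⊐⊐-snoc w (ts< i<j πgj q′))

  ⊐⊐-app : {s t : Tm (σ ⇒ τ)} (w : Tm σ) → s ⊐⊐ t → app s w ⊐⊐ app t w
  ⊐⊐-app {s = fun f # ss} {t = h # pre} w s⊐⊐t =
    rpo-appl f (snoc ss w) (h # snoc pre w) h pre (w ∷ []) pad′
      (cong (h #_) (snoc≡++ pre w)) (s≤s z≤n) (⊐⊐-snoc w s⊐⊐t) λ { here → select-w ; (there ()) }
    where
      pad      = ⊐⊐-Padded s⊐⊐t
      pad′     = Padded-snoc ss w pad
      select-w = rpo-select f (snoc ss w) pad′
                   (suc (len ss) , _ , w , Padded-next ss pad , snoc-[]=-last ss w , ⊒-≈ (≈-refl w))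

  app-mono-⊐ : {s t : Tm (σ ⇒ τ)} (w : Tm σ) → s ⊐ t → app s w ⊐ app t w
  app-mono-⊐ w (gr-mono x ss ts ss⊒ts (i , _ , _ , a , b , p , q , a⊐b)) =
    gr-mono x (snoc ss w) (snoc ts w)
      (snoc-pointwise (λ _ → ⊤) _⊒_ refl (⊒-≈ (≈-refl w)) (λ _ → ss⊒ts) tt)
      (i , _ , _ , a , b , snoc-[]= p , snoc-[]= q , a⊐b)
  app-mono-⊐ w (gr-args f g ss ts e f≡g πf≡πg ss⊒ts (i , _ , _ , a , b , πfi , p , q , a⊐b)) =
    gr-args f g (snoc ss w) (snoc ts w) e f≡g πf≡πg
      (snoc-pointwise (λ i → T (π f i)) _⊒_ e (⊒-≈ (≈-refl w)) ss⊒ts)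
      (i , _ , _ , a , b , πfi , snoc-[]= p , snoc-[]= q , a⊐b)
  app-mono-⊐ w (gr-rpo s⊐⊐t) = gr-rpo (⊐⊐-app w s⊐⊐t)

  app-mono-≈ : {s t : Tm (σ ⇒ τ)} (w : Tm σ) → s ≈ t → app s w ≈ app t w
  app-mono-≈ w (eq-mono x ss ts ss≈ts) =
    eq-mono x (snoc ss w) (snoc ts w)
      (snoc-pointwise (λ _ → ⊤) _≈_ refl (≈-refl w) (λ _ → ss≈ts) tt)
  app-mono-≈ w (eq-args f g ss ts e f≡g πf≡πg ss≈ts) =
    eq-args f g (snoc ss w) (snoc ts w) e f≡g πf≡πg
      (snoc-pointwise (λ i → T (π f i)) _≈_ e (≈-refl w) ss≈ts)

  app-mono-⊒ : {s t : Tm (σ ⇒ τ)} (w : Tm σ) → s ⊒ t → app s w ⊒ app t w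
  app-mono-⊒ w (⊒-≈ s≈t) = ⊒-≈ (app-mono-≈ w s≈t)
  app-mono-⊒ w (⊒-⊐ s⊐t) = ⊒-⊐ (app-mono-⊐ w s⊐t)

  terminating-⊒ : {s t : Tm σ} → s ⊒ t → Terminating s → Terminating t
  terminating-⊒ (⊒-⊐ s⊐t) (acc rs) = rs s⊐t
  terminating-⊒ (⊒-≈ s≈t) (acc rs) = acc λ t⊐u → rs (≈-⊐-trans s≈t t⊐u)

  terminating-app⁻ : {s : Tm (σ ⇒ τ)} (w : Tm σ) → Terminating (app s w) → Terminating s
  terminating-app⁻ w (acc rs) = acc λ s⊐t → terminating-app⁻ w (rs (app-mono-⊐ w s⊐t))

  infix 4 _⊒*_ _⊐*_ _⊏*_

  data _⊒*_ : Args σ ρ → Args σ ρ → Set where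
    []  : [] {σ} ⊒* []
    _∷_ : {s t : Tm α} {ss ts : Args β ρ} → s ⊒ t → ss ⊒* ts → (s ∷ ss) ⊒* (t ∷ ts)

  data _⊐*_ : Args σ ρ → Args σ ρ → Set where
    head : {s t : Tm α} {ss ts : Args β ρ} → s ⊐ t → ss ⊒* ts → (s ∷ ss) ⊐* (t ∷ ts)
    tail : {s t : Tm α} {ss ts : Args β ρ} → s ⊒ t → ss ⊐* ts → (s ∷ ss) ⊐* (t ∷ ts)

  _⊏*_ : Args σ ρ → Args σ ρ → Set
  ts ⊏* ss = ss ⊐* ts

  ⊐*⇒⊒* : {ss ts : Args σ ρ} → ss ⊐* ts → ss ⊒* ts
  ⊐*⇒⊒* (head s⊐t ss⊒ts) = ⊒-⊐ s⊐t ∷ ss⊒ts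
  ⊐*⇒⊒* (tail s⊒t ss⊐ts) = s⊒t ∷ ⊐*⇒⊒* ss⊐ts

  pointwise⇒⊒* : (ss ts : Args σ ρ) → Pointwise _⊒_ ss ts → ss ⊒* ts
  pointwise⇒⊒* []       []       _     = []
  pointwise⇒⊒* []       (_ ∷ ts) _     = ⊥-elim (¬Args-growing ts)
  pointwise⇒⊒* (_ ∷ ss) []       _     = ⊥-elim (¬Args-growing ss)
  pointwise⇒⊒* (_ ∷ ss) (_ ∷ ts) ss⊒ts =
    ss⊒ts here here ∷ pointwise⇒⊒* ss ts (λ p q → ss⊒ts (there p) (there q))

  pointwise⇒⊐* : (ss ts : Args σ ρ) → Pointwise _⊒_ ss ts →
                 (Σ[ i ∈ ℕ ] Σ[ α ∈ Ty ] Σ[ β ∈ Ty ] Σ[ a ∈ Tm α ] Σ[ b ∈ Tm β ]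
                    (ss [ i ]= a) × (ts [ i ]= b) × (a ⊐ b)) →
                 ss ⊐* ts
  pointwise⇒⊐* (_ ∷ ss) []       _     _ = ⊥-elim (¬Args-growing ss)
  pointwise⇒⊐* (_ ∷ ss) (_ ∷ ts) ss⊒ts (_ , _ , _ , _ , _ , here , here , a⊐b) =
    head a⊐b (pointwise⇒⊒* ss ts (λ p q → ss⊒ts (there p) (there q)))
  pointwise⇒⊐* (_ ∷ ss) (_ ∷ ts) ss⊒ts (_ , _ , _ , a , b , there p , there q , a⊐b) =
    tail (ss⊒ts here here)
      (pointwise⇒⊐* ss ts (λ p q → ss⊒ts (there p) (there q)) (_ , _ , _ , a , b , p , q , a⊐b))
  pointwise⇒⊐* (_ ∷ _)  (_ ∷ _)  _     (_ , _ , _ , _ , _ , here , there () , _)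
  pointwise⇒⊐* (_ ∷ _)  (_ ∷ _)  _     (_ , _ , _ , _ , _ , there () , here , _)

  AllTerminating : Args σ ρ → Set
  AllTerminating []       = ⊤
  AllTerminating (s ∷ ss) = Terminating s × AllTerminating ss

  AllTerminating-⊒* : {ss ts : Args σ ρ} → ss ⊒* ts → AllTerminating ss → AllTerminating ts
  AllTerminating-⊒* []            _          = tt
  AllTerminating-⊒* (s⊒t ∷ ss⊒ts) (s↓ , ss↓) =
    terminating-⊒ s⊒t s↓ , AllTerminating-⊒* ss⊒ts ss↓

  AllTerminating-⊐* : {ss ts : Args σ ρ} → ss ⊐* ts → AllTerminating ss → AllTerminating ts
  AllTerminating-⊐* ss⊐ts = AllTerminating-⊒* (⊐*⇒⊒* ss⊐ts)

  AllTerminating-snoc : (ss : Args ρ (σ ⇒ τ)) {w : Tm σ} →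
                        AllTerminating ss → Terminating w → AllTerminating (snoc ss w)
  AllTerminating-snoc []       _          w↓ = w↓ , tt
  AllTerminating-snoc (_ ∷ ss) (s↓ , ss↓) w↓ = s↓ , AllTerminating-snoc ss ss↓ w↓

  ≈-∷-acc : {s t : Tm α} {ts : Args β ρ} → s ≈ t → Acc _⊏*_ (s ∷ ts) → Acc _⊏*_ (t ∷ ts)
  ≈-∷-acc s≈t (acc rs) = acc λ
    { (head t⊐u ts⊒us) → rs (head (≈-⊐-trans s≈t t⊐u) ts⊒us)
    ; (tail t⊒u ts⊐us) → rs (tail (≈-⊒-trans s≈t t⊒u) ts⊐us) }

  -- Outer induction on the accessibility of the head, inner on that of the tail.
  ∷-acc : {s : Tm α} → Terminating s →
          ((ss : Args β ρ) → AllTerminating ss → Acc _⊏*_ ss) →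
          (ss : Args β ρ) → AllTerminating ss → Acc _⊏*_ (s ∷ ss)
  ∷-acc {s = s} (acc s-acc) tails-acc ss ss↓ = go (tails-acc ss ss↓) ss↓
    where
      go : {ss : Args _ _} → Acc _⊏*_ ss → AllTerminating ss → Acc _⊏*_ (s ∷ ss)
      go (acc ss-acc) ss↓ = acc λ
        { (head s⊐t ss⊒ts)       → ∷-acc (s-acc s⊐t) tails-acc _ (AllTerminating-⊒* ss⊒ts ss↓)
        ; (tail (⊒-⊐ s⊐t) ss⊐ts) → ∷-acc (s-acc s⊐t) tails-acc _ (AllTerminating-⊐* ss⊐ts ss↓)
        ; (tail (⊒-≈ s≈t) ss⊐ts) →
            ≈-∷-acc s≈t (go (ss-acc ss⊐ts) (AllTerminating-⊐* ss⊐ts ss↓)) }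

  ⊐*-acc : (ss : Args σ ρ) → AllTerminating ss → Acc _⊏*_ ss
  ⊐*-acc []       _          = acc λ ()
  ⊐*-acc (_ ∷ ss) (s↓ , ss↓) = ∷-acc s↓ ⊐*-acc ss ss↓

  var-terminating : (x : ℕ) (ss : Args σ ρ) → Acc _⊏*_ ss → Terminating (var σ x # ss)
  var-terminating x ss (acc ss-acc) = acc λ
    { (gr-mono .x .ss ts ss⊒ts strict) →
        var-terminating x ts (ss-acc (pointwise⇒⊐* ss ts ss⊒ts strict))
    ; (gr-rpo ()) }

  mutual
    var-computable : ∀ τ (x : ℕ) (ss : Args σ τ) → AllTerminating ss → Computable τ (var σ x # ss)
    var-computable ι       x ss ss↓          = var-terminating x ss (⊐*-acc ss ss↓)
    var-computable (σ ⇒ τ) x ss ss↓ w w-comp =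
      var-computable τ x (snoc ss w)
        (AllTerminating-snoc ss ss↓ (computable⇒terminating σ w w-comp))

    computable⇒terminating : ∀ σ (s : Tm σ) → Computable σ s → Terminating s
    computable⇒terminating ι       s s-comp = s-comp
    computable⇒terminating (σ ⇒ τ) s s-comp =
      terminating-app⁻ x (computable⇒terminating τ (app s x) (s-comp x (var-computable σ 0 [] tt)))
      where
        x : Tm σ
        x = v σ 0

  v-computable : ∀ σ (x : ℕ) → Computable σ (v σ x)
  v-computable σ x = var-computable σ x [] tt

  computable-⊒ : ∀ σ (s t : Tm σ) → Computable σ s → s ⊒ t → Computable σ t
  computable-⊒ ι       s t s-comp s⊒t          = terminating-⊒ s⊒t s-comp
  computable-⊒ (σ ⇒ τ) s t s-comp s⊒t w w-comp =
    computable-⊒ τ (app s w) (app t w) (s-comp w w-comp) (app-mono-⊒ w s⊒t)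

lemma9 : (S : Setup) → let open Terms S in
    ((σ : Ty) (x : ℕ) → Computable σ (v σ x))
    × ((σ : Ty) (s : Tm σ) → Computable σ s → Terminating s)
    × ((σ : Ty) (s t : Tm σ) → Computable σ s → s ⊒ t → Computable σ t)
lemma9 S = v-computable , computable⇒terminating , computable-⊒
  where open Properties S
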